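{- For a nontrivial $(n,m;k_1,\dots,k_m;\ell)$-RWEDF in a finite abelian group $G$ of order $n$, we have $\ell<m$, and if $\ell$ is an integer then $\ell\le m-1$.
   Context: $G$ is a finite abelian group of order $n$, written additively, $G^*=G\setminus\{0\}$. For pairwise disjoint nonempty subsets $A_1,\dots,A_m$ of $G$ and $\delta\in G^*$, let $N_i(\delta)=|\{(a_i,a_j): a_i\in A_i,\ a_j\in A_j \text{ for some } j\neq i,\ a_i-a_j=\delta\}|$. An $(n,m;k_1,\dots,k_m;\ell)$-RWEDF is a collection of pairwise disjoint subsets $A_1,\dots,A_m$ of $G$ with $|A_i|=k_i$ such that $\sum_{i=1}^m \frac{1}{k_i}N_i(\delta)=\ell$ for every $\delta\in G^*$ ($\ell\in\mathbb{Q}$). The trivial RWEDFs are the one with $m=1$ and $A_1=G$, and the one with $m=n$ consisting of all singletons $\{g\}$, $g\in G$; an RWEDF is nontrivial if it is not one of these. -}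

module Defs where

open import Data.Nat using (ℕ; zero; suc; _+_)
open import Data.Bool using (Bool; true; false; _∧_; _∨_; not; if_then_else_)
open import Data.Fin using (Fin; zero; suc)
import Data.Fin.Properties as FinP
open import Data.Integer using (ℤ; +_)
open import Data.Rational using (ℚ; 0ℚ; _/_) renaming (_+_ to _+ℚ_)
open import Data.Product using (Σ; ∃; _×_; _,_)
open import Function.Bundles using (_↔_; Inverse)
open import Relation.Binary.PropositionalEquality using (_≡_)
open import Relation.Nullary using (¬_; Dec; yes; no)
open import Relation.Nullary.Decidable using (⌊_⌋)
open import Algebra.Structures using (IsAbelianGroup)

-- A finite abelian group of order n (written additively), with propositional
-- equality and an explicit enumeration Fin n ↔ Carrier (so |G| = n).
record FinAbGroup (n : ℕ) : Set₁ where
  field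
    Carrier : Set
    _⊕_     : Carrier → Carrier → Carrier
    𝟘       : Carrier
    ⊖_      : Carrier → Carrier
    isAbelianGroup : IsAbelianGroup _≡_ _⊕_ 𝟘 ⊖_
    enum    : Fin n ↔ Carrier

  elt : Fin n → Carrier
  elt = Inverse.to enum

  idx : Carrier → Fin n
  idx = Inverse.from enum

  _==_ : Carrier → Carrier → Bool
  g == h = ⌊ idx g FinP.≟ idx h ⌋

open FinAbGroup public

count : (k : ℕ) → (Fin k → Bool) → ℕ
count zero    p = 0
count (suc k) p = (if p zero then 1 else 0) + count k (λ x → p (suc x))

sumℕ : (k : ℕ) → (Fin k → ℕ) → ℕ
sumℕ zero    f = 0
sumℕ (suc k) f = f zero + sumℕ k (λ x → f (suc x))

anyF : (k : ℕ) → (Fin k → Bool) → Bool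
anyF zero    p = false
anyF (suc k) p = p zero ∨ anyF k (λ x → p (suc x))

sumℚ : (m : ℕ) → (Fin m → ℚ) → ℚ
sumℚ zero    f = 0ℚ
sumℚ (suc m) f = f zero +ℚ sumℚ m (λ i → f (suc i))

-- a / k as a rational; the k = 0 case never occurs for RWEDFs (blocks are nonempty)
frac : ℕ → ℕ → ℚ
frac a zero    = 0ℚ
frac a (suc k) = (+ a) / suc k

module _ {n : ℕ} (G : FinAbGroup n) {m : ℕ} (mem : Fin m → Carrier G → Bool) where

  blockSize : Fin m → ℕ
  blockSize i = count n (λ x → mem i (elt G x))

  inOther : Fin m → Carrier G → Bool
  inOther i g = anyF m (λ j → not ⌊ i FinP.≟ j ⌋ ∧ mem j g)

  N : Fin m → Carrier G → ℕ
  N i δ = sumℕ n (λ x → count n (λ y →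
            mem i (elt G x) ∧ inOther i (elt G y)
              ∧ (_==_ G (_⊕_ G (elt G x) (⊖_ G (elt G y))) δ)))

  record Blocks (k : Fin m → ℕ) : Set where
    field
      disjoint : ∀ i j g → mem i g ≡ true → mem j g ≡ true → i ≡ j
      nonempty : ∀ i → ∃ λ g → mem i g ≡ true
      sizes    : ∀ i → blockSize i ≡ k i

  record IsRWEDF (k : Fin m → ℕ) (ℓ : ℚ) : Set where
    field
      blocks  : Blocks k
      balance : ∀ δ → ¬ (δ ≡ 𝟘 G) → sumℚ m (λ i → frac (N i δ) (k i)) ≡ ℓ

  Trivial₁ : Set
  Trivial₁ = (m ≡ 1) × (∀ i g → mem i g ≡ true)

  Trivial₂ : Set
  Trivial₂ = (m ≡ n) × (∀ i → blockSize i ≡ 1) × (∀ g → ∃ λ i → mem i g ≡ true)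

  Nontrivial : Set
  Nontrivial = ¬ Trivial₁ × ¬ Trivial₂

-- For a ∈ A_i and δ ≠ 0 there is exactly one b ∈ G with a - b = δ, so every
-- a ∈ A_i contributes at most one pair to N_i(δ).  Hence N_i(δ) ≤ k_i, each
-- summand N_i(δ)/k_i is at most 1, and ℓ ≤ m.  The inequality is strict as soon
-- as some a ∈ A_i has its δ-partner a - δ outside the other blocks (an
-- "unmatched" element).  If no unmatched element exists at all, then
--   * every block is a singleton (for g ≠ g' in A_i, the partner of g for
--     δ = g - g' is g' ∈ A_i itself), and
--   * the blocks cover G (for g in no block, the partner of any a ∈ A_1 for
--     δ = a - g is g),
-- so the RWEDF is the trivial one made of all singletons.
module Submission where

open import Defs
open import Data.Nat using (ℕ; _≤_)
open import Data.Bool using (Bool)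
open import Data.Fin using (Fin)
open import Data.Integer using (ℤ; +_)
open import Data.Rational using (ℚ; _/_; _<_; _-_; 1ℚ) renaming (_≤_ to _≤ℚ_)
open import Data.Product using (_×_)
open import Relation.Binary.PropositionalEquality using (_≡_)

open import Data.Nat using (zero; suc; z≤n; s≤s) renaming (_<_ to _<ℕ_)
import Data.Nat.Properties as ℕP
open import Data.Bool using (true; false; _∧_; not; if_then_else_)
open import Data.Fin using (zero; suc)
import Data.Fin.Properties as FinP
import Data.Integer as ℤ
import Data.Integer.Properties as ℤP
open import Data.Rational using (toℚᵘ; -_) renaming (_+_ to _+ℚ_)
import Data.Rational.Properties as ℚP
open import Data.Rational.Unnormalised as ℚᵘ using (mkℚᵘ; *≡*; *≤*; *<*)
  renaming (_≃_ to _≃ᵘ_; _≤_ to _≤ᵘ_)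
import Data.Rational.Unnormalised.Properties as ℚᵘP
open import Data.Product using (∃; _,_; proj₁; proj₂)
open import Data.Empty using (⊥-elim)
open import Relation.Nullary using (¬_; Dec; yes; no)
open import Relation.Nullary.Decidable using (⌊_⌋; map′; decidable-stable)
open import Relation.Binary.PropositionalEquality
  using (_≢_; refl; sym; trans; cong; subst; subst₂)
open import Function.Bundles using (Inverse)
open import Algebra.Bundles using (Group)
open import Algebra.Structures using (IsAbelianGroup)

ind : Bool → ℕ
ind b = if b then 1 else 0

sumℕ-ind : ∀ k (p : Fin k → Bool) → sumℕ k (λ x → ind (p x)) ≡ count k p
sumℕ-ind zero    p = refl
sumℕ-ind (suc k) p = cong (Data.Nat._+_ (ind (p zero))) (sumℕ-ind k (λ x → p (suc x)))

count-none : ∀ k (p : Fin k → Bool) → (∀ x → p x ≡ false) → count k p ≡ 0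
count-none zero    p none = refl
count-none (suc k) p none rewrite none zero = count-none k _ (λ x → none (suc x))

count-some : ∀ k (p : Fin k → Bool) x → p x ≡ true → 1 ≤ count k p
count-some (suc k) p zero    px rewrite px = s≤s z≤n
count-some (suc k) p (suc x) px =
  ℕP.≤-trans (count-some k _ x px) (ℕP.m≤n+m _ (ind (p zero)))

count-unique : ∀ k (p : Fin k → Bool) → (∀ x y → p x ≡ true → p y ≡ true → x ≡ y)
             → count k p ≤ 1
count-unique zero    p uniq = z≤n
count-unique (suc k) p uniq with p zero in p0
... | true  = ℕP.≤-reflexive (cong suc (count-none k _ rest-false))
  where
  rest-false : ∀ x → p (suc x) ≡ false
  rest-false x with p (suc x) in px
  ... | true  with () ← uniq zero (suc x) p0 px
  ... | false = refl
... | false = count-unique k _ (λ x y px py → FinP.suc-injective (uniq _ _ px py))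

sumℕ-mono-≤ : ∀ k (f g : Fin k → ℕ) → (∀ x → f x ≤ g x) → sumℕ k f ≤ sumℕ k g
sumℕ-mono-≤ zero    f g f≤g = z≤n
sumℕ-mono-≤ (suc k) f g f≤g =
  ℕP.+-mono-≤ (f≤g zero) (sumℕ-mono-≤ k _ _ (λ x → f≤g (suc x)))

sumℕ-mono-< : ∀ k (f g : Fin k → ℕ) → (∀ x → f x ≤ g x) → ∀ x₀ → f x₀ <ℕ g x₀
            → sumℕ k f <ℕ sumℕ k g
sumℕ-mono-< (suc k) f g f≤g zero     lt =
  ℕP.+-mono-<-≤ lt (sumℕ-mono-≤ k _ _ (λ x → f≤g (suc x)))
sumℕ-mono-< (suc k) f g f≤g (suc x₀) lt =
  ℕP.+-mono-≤-< (f≤g zero) (sumℕ-mono-< k _ _ (λ x → f≤g (suc x)) x₀ lt)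

anyF-witness : ∀ k (p : Fin k → Bool) → anyF k p ≡ true → ∃ λ x → p x ≡ true
anyF-witness (suc k) p any with p zero in p0
... | true  = zero , p0
... | false with x , px ← anyF-witness k _ any = suc x , px

anyF-none : ∀ k (p : Fin k → Bool) → (∀ x → p x ≡ false) → anyF k p ≡ false
anyF-none zero    p none = refl
anyF-none (suc k) p none rewrite none zero = anyF-none k _ (λ x → none (suc x))

anyF-false : ∀ k (p : Fin k → Bool) → anyF k p ≡ false → ∀ x → p x ≡ false
anyF-false (suc k) p any zero    with p zero
... | false = refl
anyF-false (suc k) p any (suc x) with p zero
... | false = anyF-false k _ any x

some-index : ∀ {m} → 1 ≤ m → Fin m
some-index {suc _} _ = zero

∧-zeroʳ : ∀ a → a ∧ false ≡ false
∧-zeroʳ true  = refl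
∧-zeroʳ false = refl

∧-elimʳ : ∀ a b → a ∧ b ≡ true → b ≡ true
∧-elimʳ true b ab = ab

toℚᵘ-/1 : ∀ z → toℚᵘ (z / 1) ≃ᵘ mkℚᵘ z 0
toℚᵘ-/1 z = ℚP.toℚᵘ-fromℚᵘ (mkℚᵘ z 0)

/1-suc : ∀ m → (+ suc m) / 1 ≡ 1ℚ +ℚ (+ m) / 1
/1-suc m = ℚP.toℚᵘ-injective (begin
  toℚᵘ ((+ suc m) / 1)                ≈⟨ toℚᵘ-/1 (+ suc m) ⟩
  mkℚᵘ (+ suc m) 0                     ≈⟨ suc≃1+ ⟩
  ℚᵘ.1ℚᵘ ℚᵘ.+ mkℚᵘ (+ m) 0            ≈⟨ ℚᵘP.+-congʳ ℚᵘ.1ℚᵘ (ℚᵘP.≃-sym (toℚᵘ-/1 (+ m))) ⟩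
  ℚᵘ.1ℚᵘ ℚᵘ.+ toℚᵘ ((+ m) / 1)        ≈⟨ ℚᵘP.≃-sym (ℚP.toℚᵘ-homo-+ 1ℚ ((+ m) / 1)) ⟩
  toℚᵘ (1ℚ +ℚ (+ m) / 1)                ∎)
  where
  open ℚᵘP.≃-Reasoning
  suc≃1+ : mkℚᵘ (+ suc m) 0 ≃ᵘ ℚᵘ.1ℚᵘ ℚᵘ.+ mkℚᵘ (+ m) 0
  suc≃1+ = *≡* (cong (ℤ._* + 1) (sym (cong (ℤ._+_ ℤ.1ℤ) (ℤP.*-identityʳ (+ m)))))

sumℚ-ones : ∀ m → sumℚ m (λ _ → 1ℚ) ≡ (+ m) / 1
sumℚ-ones zero    = refl
sumℚ-ones (suc m) = trans (cong (1ℚ +ℚ_) (sumℚ-ones m)) (sym (/1-suc m))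

sumℚ-mono-≤ : ∀ m (f g : Fin m → ℚ) → (∀ i → f i ≤ℚ g i) → sumℚ m f ≤ℚ sumℚ m g
sumℚ-mono-≤ zero    f g f≤g = ℚP.≤-refl
sumℚ-mono-≤ (suc m) f g f≤g =
  ℚP.+-mono-≤ (f≤g zero) (sumℚ-mono-≤ m _ _ (λ i → f≤g (suc i)))

sumℚ-mono-< : ∀ m (f g : Fin m → ℚ) → (∀ i → f i ≤ℚ g i) → ∀ i₀ → f i₀ < g i₀
            → sumℚ m f < sumℚ m g
sumℚ-mono-< (suc m) f g f≤g zero     lt =
  ℚP.+-mono-<-≤ lt (sumℚ-mono-≤ m _ _ (λ i → f≤g (suc i)))
sumℚ-mono-< (suc m) f g f≤g (suc i₀) lt =
  ℚP.+-mono-≤-< (f≤g zero) (sumℚ-mono-< m _ _ (λ i → f≤g (suc i)) i₀ lt)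

toℚᵘ-frac : ∀ a b → toℚᵘ (frac a (suc b)) ≃ᵘ mkℚᵘ (+ a) b
toℚᵘ-frac a b = ℚP.toℚᵘ-fromℚᵘ (mkℚᵘ (+ a) b)

frac≤1 : ∀ a b → a ≤ b → 1 ≤ b → frac a b ≤ℚ 1ℚ
frac≤1 a (suc b) a≤b _ = ℚP.toℚᵘ-cancel-≤ (ℚᵘP.≤-respˡ-≃ (ℚᵘP.≃-sym (toℚᵘ-frac a b))
  (*≤* (subst₂ ℤ._≤_ (sym (ℤP.*-identityʳ (+ a))) (sym (ℤP.*-identityˡ (+ suc b)))
                     (ℤ.+≤+ a≤b))))

frac<1 : ∀ a b → a <ℕ b → frac a b < 1ℚ
frac<1 a (suc b) a<b = ℚP.toℚᵘ-cancel-< (ℚᵘP.<-respˡ-≃ (ℚᵘP.≃-sym (toℚᵘ-frac a b))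
  (*<* (subst₂ ℤ._<_ (sym (ℤP.*-identityʳ (+ a))) (sym (ℤP.*-identityˡ (+ suc b)))
                     (ℤ.+<+ a<b))))

sum-fractions<m : ∀ m (a b : Fin m → ℕ) → (∀ j → a j ≤ b j) → (∀ j → 1 ≤ b j)
                → ∀ i → a i <ℕ b i → sumℚ m (λ j → frac (a j) (b j)) < (+ m) / 1
sum-fractions<m m a b a≤b b≥1 i a<b =
  subst (sumℚ m (λ j → frac (a j) (b j)) <_) (sumℚ-ones m)
    (sumℚ-mono-< m _ _ (λ j → frac≤1 (a j) (b j) (a≤b j) (b≥1 j)) i (frac<1 (a i) (b i) a<b))

integer<⇒≤pred : ∀ z w → z / 1 < w / 1 → z / 1 ≤ℚ w / 1 - 1ℚ
integer<⇒≤pred z w z<w = ℚP.toℚᵘ-cancel-≤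
  (ℚᵘP.≤-respˡ-≃ (ℚᵘP.≃-sym (toℚᵘ-/1 z)) (ℚᵘP.≤-respʳ-≃ (ℚᵘP.≃-sym w-1) z≤w-1))
  where
  z<w-ℤ : z ℤ.< w
  z<w-ℤ with *<* lt ← ℚᵘP.<-respʳ-≃ (toℚᵘ-/1 w)
                        (ℚᵘP.<-respˡ-≃ (toℚᵘ-/1 z) (ℚP.toℚᵘ-mono-< z<w))
    = subst₂ ℤ._<_ (ℤP.*-identityʳ z) (ℤP.*-identityʳ w) lt
  w-1 : toℚᵘ (w / 1 - 1ℚ) ≃ᵘ mkℚᵘ w 0 ℚᵘ.+ ℚᵘ.- ℚᵘ.1ℚᵘ
  w-1 = ℚᵘP.≃-trans (ℚP.toℚᵘ-homo-+ (w / 1) (- 1ℚ))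
          (ℚᵘP.+-cong (toℚᵘ-/1 w) (ℚP.toℚᵘ-homo‿- 1ℚ))
  z≤w-1 : mkℚᵘ z 0 ≤ᵘ mkℚᵘ w 0 ℚᵘ.+ ℚᵘ.- ℚᵘ.1ℚᵘ
  z≤w-1 = *≤* (subst₂ ℤ._≤_ (sym (ℤP.*-identityʳ z)) pred-w (ℤP.i<j⇒i≤pred[j] z<w-ℤ))
    where
    pred-w : ℤ.pred w ≡ (w ℤ.* + 1 ℤ.+ ℤ.-1ℤ ℤ.* + 1) ℤ.* + 1
    pred-w = trans (ℤP.+-comm ℤ.-1ℤ w)
               (sym (trans (ℤP.*-identityʳ _) (cong (ℤ._+ ℤ.-1ℤ) (ℤP.*-identityʳ w))))

module Differences {n : ℕ} (G : FinAbGroup n) where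

  C : Set
  C = Carrier G

  infixl 6 _⊝_
  _⊝_ : C → C → C
  a ⊝ b = _⊕_ G a (⊖_ G b)

  elt-idx : ∀ g → elt G (idx G g) ≡ g
  elt-idx = Inverse.strictlyInverseˡ (enum G)

  idx-injective : ∀ {g h} → idx G g ≡ idx G h → g ≡ h
  idx-injective {g} {h} eq = trans (sym (elt-idx g)) (trans (cong (elt G) eq) (elt-idx h))

  idx-elt : ∀ x → idx G (elt G x) ≡ x
  idx-elt = Inverse.strictlyInverseʳ (enum G)

  elt-injective : ∀ {x y} → elt G x ≡ elt G y → x ≡ y
  elt-injective {x} {y} eq = trans (sym (idx-elt x)) (trans (cong (idx G) eq) (idx-elt y))

  ==-sound : ∀ g h → _==_ G g h ≡ true → g ≡ h
  ==-sound g h eq with idx G g FinP.≟ idx G h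
  ... | yes same = idx-injective same

  _≟_ : ∀ (g h : C) → Dec (g ≡ h)
  g ≟ h = map′ idx-injective (cong (idx G)) (idx G g FinP.≟ idx G h)

  -- G as a group bundle, to reuse the library's cancellation laws.
  group : Group _ _
  group = record { isGroup = IsAbelianGroup.isGroup (isAbelianGroup G) }

  open import Algebra.Properties.Group group using (∙-cancelˡ; ⁻¹-injective; x∙y⁻¹≈ε⇒x≈y)

  ⊝-cancelˡ : ∀ a b b' → a ⊝ b ≡ a ⊝ b' → b ≡ b'
  ⊝-cancelˡ a b b' eq = ⁻¹-injective (∙-cancelˡ a _ _ eq)

  ⊝≡0 : ∀ a b → a ⊝ b ≡ 𝟘 G → a ≡ b
  ⊝≡0 = x∙y⁻¹≈ε⇒x≈y

-- The partner bound N_i(δ) ≤ |A_i| and when it is strict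

module PartnerBound {n : ℕ} (G : FinAbGroup n) {m : ℕ} (mem : Fin m → Carrier G → Bool) where
  open Differences G

  pair : Fin m → C → Fin n → Fin n → Bool
  pair i δ x y = mem i (elt G x) ∧ inOther G mem i (elt G y) ∧ _==_ G (elt G x ⊝ elt G y) δ

  partners≤1 : ∀ i δ x → count n (pair i δ x) ≤ ind (mem i (elt G x))
  partners≤1 i δ x with mem i (elt G x)
  ... | false = ℕP.≤-reflexive (count-none n _ (λ _ → refl))
  ... | true  = count-unique n _ λ y y' p p' →
    elt-injective (⊝-cancelˡ (elt G x) _ _
      (trans (==-sound _ δ (∧-elimʳ (inOther G mem i (elt G y)) _ p))
             (sym (==-sound _ δ (∧-elimʳ (inOther G mem i (elt G y')) _ p')))))

  N≤blockSize : ∀ i δ → N G mem i δ ≤ blockSize G mem i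
  N≤blockSize i δ = ℕP.≤-trans (sumℕ-mono-≤ n _ _ (partners≤1 i δ))
                               (ℕP.≤-reflexive (sumℕ-ind n _))

  member⇒blockSize≥1 : ∀ i g → mem i g ≡ true → 1 ≤ blockSize G mem i
  member⇒blockSize≥1 i g g∈i =
    count-some n _ (idx G g) (subst (λ h → mem i h ≡ true) (sym (elt-idx g)) g∈i)

  record Unmatched : Set where
    field
      block          : Fin m
      shift          : C
      shift≢0        : shift ≢ 𝟘 G
      point          : C
      point∈block    : mem block point ≡ true
      partnerOutside : ∀ g → point ⊝ g ≡ shift → inOther G mem block g ≡ false

  unmatched⇒N<blockSize : (u : Unmatched) → let open Unmatched u in
                          N G mem block shift <ℕ blockSize G mem block
  unmatched⇒N<blockSize u = ℕP.<-≤-trans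
    (sumℕ-mono-< n _ _ (partners≤1 block shift) x₀ no-partner)
    (ℕP.≤-reflexive (sumℕ-ind n _))
    where
    open Unmatched u
    x₀ : Fin n
    x₀ = idx G point
    point∈block' : mem block (elt G x₀) ≡ true
    point∈block' = subst (λ g → mem block g ≡ true) (sym (elt-idx point)) point∈block
    not-pair : ∀ y → pair block shift x₀ y ≡ false
    not-pair y with _==_ G (elt G x₀ ⊝ elt G y) shift in is-partner
    ... | false = trans (cong (mem block (elt G x₀) ∧_) (∧-zeroʳ _)) (∧-zeroʳ _)
    ... | true  rewrite partnerOutside (elt G y)
                          (subst (λ g → g ⊝ elt G y ≡ shift) (elt-idx point)
                                 (==-sound _ shift is-partner))
                = ∧-zeroʳ _
    no-partner : count n (pair block shift x₀) <ℕ ind (mem block (elt G x₀))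
    no-partner rewrite count-none n _ not-pair | point∈block' = s≤s z≤n

-- Without unmatched elements the blocks are all the singletons of G

module SingletonClassification {n : ℕ} (G : FinAbGroup n) {m : ℕ} (mem : Fin m → Carrier G → Bool)
  {k : Fin m → ℕ} (B : Blocks G mem k) (allMatched : ¬ PartnerBound.Unmatched G mem) where
  open Differences G
  open Blocks B

  notInOther : ∀ i g → mem i g ≡ true → inOther G mem i g ≡ false
  notInOther i g g∈i = anyF-none m _ other-j
    where
    other-j : ∀ j → (not ⌊ i FinP.≟ j ⌋ ∧ mem j g) ≡ false
    other-j j with i FinP.≟ j
    ... | yes _ = refl
    ... | no i≢j with mem j g in g∈j
    ...   | true  = ⊥-elim (i≢j (disjoint i j g g∈i g∈j))
    ...   | false = refl

  -- Two distinct g, g' ∈ A_i: the (g - g')-partner of g is g' ∈ A_i, so g is unmatched.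
  singleton : ∀ i g g' → mem i g ≡ true → mem i g' ≡ true → g ≡ g'
  singleton i g g' g∈i g'∈i with g ≟ g'
  ... | yes g≡g' = g≡g'
  ... | no  g≢g' = ⊥-elim (allMatched record
    { block = i ; shift = g ⊝ g' ; shift≢0 = λ eq → g≢g' (⊝≡0 g g' eq)
    ; point = g ; point∈block = g∈i
    ; partnerOutside = λ h eq →
        notInOther i h (subst (λ x → mem i x ≡ true) (⊝-cancelˡ g g' h (sym eq)) g'∈i) })

  -- An element g in no block: the (a - g)-partner of any a ∈ A_1 is g, so a is unmatched.
  covering : 1 ≤ m → ∀ g → ∃ λ i → mem i g ≡ true
  covering m≥1 g with anyF m (λ j → mem j g) in somewhere
  ... | true  = anyF-witness m _ somewhere
  ... | false = ⊥-elim (allMatched record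
    { block = i₀ ; shift = a ⊝ g ; shift≢0 = λ eq → a≢g (⊝≡0 a g eq)
    ; point = a ; point∈block = a∈i₀
    ; partnerOutside = λ h eq → subst (λ x → inOther G mem i₀ x ≡ false)
        (⊝-cancelˡ a g h (sym eq)) g∉other })
    where
    i₀ : Fin m
    i₀ = some-index m≥1
    nowhere : ∀ j → mem j g ≡ false
    nowhere = anyF-false m _ somewhere
    g∉other : inOther G mem i₀ g ≡ false
    g∉other = anyF-none m _ λ j → trans (cong (not ⌊ i₀ FinP.≟ j ⌋ ∧_) (nowhere j)) (∧-zeroʳ _)
    a : C
    a = proj₁ (nonempty i₀)
    a∈i₀ : mem i₀ a ≡ true
    a∈i₀ = proj₂ (nonempty i₀)
    a≢g : a ≢ g
    a≢g refl with () ← trans (sym a∈i₀) (nowhere i₀)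

  blockSize≡1 : ∀ i → blockSize G mem i ≡ 1
  blockSize≡1 i = ℕP.≤-antisym
    (count-unique n _ (λ x y x∈i y∈i → elt-injective (singleton i _ _ x∈i y∈i)))
    (PartnerBound.member⇒blockSize≥1 G mem i _ (proj₂ (nonempty i)))

  -- The blocks are in bijection with G: a block ↦ its element is injective by
  -- disjointness, g ↦ its block is injective since blocks are singletons.
  m≡n : 1 ≤ m → m ≡ n
  m≡n m≥1 = ℕP.≤-antisym (FinP.injective⇒≤ {f = element} element-injective)
                         (FinP.injective⇒≤ {f = blockOf} blockOf-injective)
    where
    element : Fin m → Fin n
    element i = idx G (proj₁ (nonempty i))
    element-injective : ∀ {i j} → element i ≡ element j → i ≡ j
    element-injective {i} {j} eq = disjoint i j _ (proj₂ (nonempty i))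
      (subst (λ g → mem j g ≡ true) (sym (idx-injective eq)) (proj₂ (nonempty j)))
    blockOf : Fin n → Fin m
    blockOf x = proj₁ (covering m≥1 (elt G x))
    blockOf-injective : ∀ {x y} → blockOf x ≡ blockOf y → x ≡ y
    blockOf-injective {x} {y} eq = elt-injective (singleton (blockOf x) _ _
      (proj₂ (covering m≥1 (elt G x)))
      (subst (λ i → mem i (elt G y) ≡ true) (sym eq) (proj₂ (covering m≥1 (elt G y)))))

  allSingletons : 1 ≤ m → Trivial₂ G mem
  allSingletons m≥1 = m≡n m≥1 , blockSize≡1 , covering m≥1

blockSize≥1 : ∀ {n} (G : FinAbGroup n) {m} (mem : Fin m → Carrier G → Bool) {k : Fin m → ℕ}
            → Blocks G mem k → ∀ i → 1 ≤ k i
blockSize≥1 G mem B i =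
  subst (1 ≤_) (sizes i) (PartnerBound.member⇒blockSize≥1 G mem i _ (proj₂ (nonempty i)))
  where open Blocks B

unmatched⇒ℓ<m : ∀ {n} (G : FinAbGroup n) {m} (mem : Fin m → Carrier G → Bool) (k : Fin m → ℕ) (ℓ : ℚ)
              → IsRWEDF G mem k ℓ → PartnerBound.Unmatched G mem → ℓ < (+ m) / 1
unmatched⇒ℓ<m G {m} mem k ℓ R u = subst (_< (+ m) / 1) (balance shift shift≢0)
  (sum-fractions<m m (λ j → N G mem j shift) k
    (λ j → subst (N G mem j shift ≤_) (sizes j) (N≤blockSize j shift))
    (blockSize≥1 G mem blocks) block
    (subst (N G mem block shift <ℕ_) (sizes block) (unmatched⇒N<blockSize u)))
  where
  open IsRWEDF R
  open Blocks blocks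
  open PartnerBound G mem
  open Unmatched u

mainTheorem4 : {n : ℕ} (G : FinAbGroup n) {m : ℕ} → 1 ≤ m
    → (mem : Fin m → Carrier G → Bool) (k : Fin m → ℕ) (ℓ : ℚ)
    → IsRWEDF G mem k ℓ → Nontrivial G mem
    → (ℓ < (+ m) / 1) × ((z : ℤ) → ℓ ≡ z / 1 → ℓ ≤ℚ (+ m) / 1 - 1ℚ)
mainTheorem4 G {m} m≥1 mem k ℓ R (_ , notSingletons) = ℓ<m , ℓ-integer
  where
  -- If ℓ < m failed, no element could be unmatched, forcing the singleton RWEDF.
  ℓ<m : ℓ < (+ m) / 1
  ℓ<m = decidable-stable (ℓ ℚP.<? (+ m) / 1) λ ℓ≮m →
    notSingletons (SingletonClassification.allSingletons G mem (IsRWEDF.blocks R)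
                     (λ u → ℓ≮m (unmatched⇒ℓ<m G mem k ℓ R u)) m≥1)
  ℓ-integer : (z : ℤ) → ℓ ≡ z / 1 → ℓ ≤ℚ (+ m) / 1 - 1ℚ
  ℓ-integer z refl = integer<⇒≤pred z (+ m) ℓ<m
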